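{- Let $X$ be a regular multigraph (multiple edges allowed) of odd valency $d>1$ which is class I. Then $X$ has a cyclic truncation that is class I.
   Context: Generalized truncation of $X$: for each edge $e=[u,v]$ of $X$ take a new edge (these form a matching $M_F$) whose two ends are labelled $u$ and $v$. For each vertex $v$, the cluster $\mathrm{cl}(v)$ is the set of ends labelled $v$; insert a simple graph $\mathrm{con}(v)$ on $\mathrm{cl}(v)$. The result $M_F\cup\bigcup_v\mathrm{con}(v)$ is a generalized truncation. It is a cyclic truncation if every $\mathrm{con}(v)$ is a cycle passing through all vertices of $\mathrm{cl}(v)$. A multigraph is class I if its chromatic index (minimum number of colors in a proper edge coloring) equals its maximum valency. -}

module Defs where

open import Data.Nat using (ℕ; zero; suc; _+_; _*_; _≤_; _<_; _⊔_)
open import Data.Fin using (Fin; combine) renaming (zero to f0; suc to fs)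
open import Data.Fin.Properties using (_≟_)
open import Data.List using (List; []; _∷_; _++_; map; concatMap; foldr; length; lookup; allFin; [_])
open import Data.List.Relation.Unary.Unique.Propositional using (Unique)
open import Data.List.Membership.Propositional using (_∈_)
open import Data.Product using (Σ; ∃; _×_; _,_; proj₁; proj₂)
open import Relation.Binary.PropositionalEquality using (_≡_; _≢_)
open import Relation.Nullary using (yes; no)
open import Function.Bundles using (_⇔_)

-- Finite multigraphs (parallel edges allowed).
-- Vertices are Fin V; edges are the positions of the list 'edges';
-- the edge at position i joins the two vertices of 'lookup edges i'.

record Multigraph : Set where
  field
    V     : ℕ
    edges : List (Fin V × Fin V)

open Multigraph public

Edge : Multigraph → Set
Edge G = Fin (length (edges G))

endsOf : (G : Multigraph) → Edge G → Fin (V G) × Fin (V G)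
endsOf G e = lookup (edges G) e

endpt : (G : Multigraph) → Edge G → Fin 2 → Fin (V G)
endpt G e f0      = proj₁ (endsOf G e)
endpt G e (fs _)  = proj₂ (endsOf G e)

Loopless : Multigraph → Set
Loopless G = ∀ e → endpt G e f0 ≢ endpt G e (fs f0)

countEnds : ∀ {n} → Fin n → List (Fin n × Fin n) → ℕ
countEnds v [] = 0
countEnds v ((a , b) ∷ es) = ind a + ind b + countEnds v es
  where
  ind : _ → ℕ
  ind x with x ≟ v
  ... | yes _ = 1
  ... | no  _ = 0

degree : (G : Multigraph) → Fin (V G) → ℕ
degree G v = countEnds v (edges G)

-- maximum valency (0 for the empty graph)
maxValency : Multigraph → ℕ
maxValency G = foldr _⊔_ 0 (map (degree G) (allFin (V G)))

Regular : Multigraph → ℕ → Set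
Regular G d = ∀ v → degree G v ≡ d

Adjacent : (G : Multigraph) → Edge G → Edge G → Set
Adjacent G e e' = e ≢ e' × Σ (Fin 2) λ i → Σ (Fin 2) λ j → endpt G e i ≡ endpt G e' j

ProperColouring : (G : Multigraph) (k : ℕ) → (Edge G → Fin k) → Set
ProperColouring G k c = ∀ e e' → Adjacent G e e' → c e ≢ c e'

Colourable : Multigraph → ℕ → Set
Colourable G k = Σ (Edge G → Fin k) (ProperColouring G k)

ChromaticIndex : Multigraph → ℕ → Set
ChromaticIndex G χ = Colourable G χ × (∀ k → Colourable G k → χ ≤ k)

ClassI : Multigraph → Set
ClassI G = ChromaticIndex G (maxValency G)

-- Cyclic truncations.
-- The ends ("darts") of X: the new edge replacing edge e has the two ends
-- (e , 0) and (e , 1), labelled by endpt X e 0 and endpt X e 1.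

Dart : Multigraph → Set
Dart X = Edge X × Fin 2

label : (X : Multigraph) → Dart X → Fin (V X)
label X (e , i) = endpt X e i

-- A cyclic truncation is specified by, for each vertex v, a cyclic
-- enumeration (without repetition, of length ≥ 3, so that it is a simple
-- cycle) of exactly the cluster cl(v) = set of ends labelled v.
record CyclicData (X : Multigraph) : Set where
  field
    cyc      : Fin (V X) → List (Dart X)
    unique   : ∀ v → Unique (cyc v)
    cluster  : ∀ v (δ : Dart X) → (δ ∈ cyc v) ⇔ (label X δ ≡ v)
    long     : ∀ v → 3 ≤ length (cyc v)

open CyclicData public

consecutive : ∀ {A : Set} → List A → List (A × A)
consecutive []           = []
consecutive (a ∷ [])     = []
consecutive (a ∷ b ∷ xs) = (a , b) ∷ consecutive (b ∷ xs)

cycleEdges : ∀ {A : Set} → List A → List (A × A)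
cycleEdges []       = []
cycleEdges (a ∷ as) = consecutive (a ∷ as ++ [ a ])

-- vertices of the truncation: darts, encoded in Fin (|E| * 2)
encDart : (X : Multigraph) → Dart X → Fin (length (edges X) * 2)
encDart X (e , i) = combine e i

encPair : (X : Multigraph) → Dart X × Dart X →
          Fin (length (edges X) * 2) × Fin (length (edges X) * 2)
encPair X (a , b) = encDart X a , encDart X b

truncation : (X : Multigraph) → CyclicData X → Multigraph
truncation X T = record
  { V     = length (edges X) * 2
  ; edges = map (λ e → encDart X (e , f0) , encDart X (e , fs f0)) (allFin (length (edges X)))
            ++ concatMap (λ v → map (encPair X) (cycleEdges (cyc T v))) (allFin (V X))
  }

-- Fix a proper d-edge-colouring c of X.  At each vertex v the d darts carry
-- the d colours once each, and the cycle con(v) visits them in colour order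
-- 0, 1, …, d − 1.  Colour the cycle edge leaving a dart of colour κ by a proper
-- 3-colouring of the cycle 0 → 1 → ⋯ → d − 1 → 0, which depends on κ only,
-- and the rung of an edge of colour κ by the third colour, missing at every
-- dart of colour κ.  Both ends of a rung have the same colour, so this is a
-- proper 3-edge-colouring of the cubic truncation, which is therefore class I.

module Submission where

open import Defs
open import Data.Nat using (ℕ; zero; suc; _+_; _*_; _%_; _≤_; _<_; _⊔_; z≤n; s≤s)
import Data.Nat.Properties as ℕ
open import Data.Nat.DivMod using (_mod_; m<n⇒m%n≡m; n%n≡0; m%n<n)
open import Data.Fin using (Fin; toℕ; fromℕ<; remQuot; punchOut) renaming (zero to f0; suc to fs)
import Data.Fin.Properties as Fin
open import Data.List
  using (List; []; _∷_; _++_; [_]; map; concatMap; length; lookup; foldr; allFin; filter; cartesianProduct; tabulate; applyUpTo)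
import Data.List.Properties as List
open import Data.List.Membership.Propositional using (_∈_; _∉_)
import Data.List.Membership.Propositional.Properties as ∈
open import Data.List.Relation.Unary.All as All using (All; []; _∷_)
import Data.List.Relation.Unary.All.Properties as All
open import Data.List.Relation.Unary.Any as Any using (here; there)
import Data.List.Relation.Unary.AllPairs as AllPairs
import Data.List.Relation.Unary.AllPairs.Properties as AllPairs
open import Data.List.Relation.Unary.AllPairs using ([]; _∷_)
open import Data.List.Relation.Unary.Unique.Propositional using (Unique)
import Data.List.Relation.Unary.Unique.Propositional.Properties as Unique
open import Data.Product using (Σ; ∃; _×_; _,_; proj₁; proj₂; map₂)
import Data.Product.Properties as Product
open import Data.Sum using (_⊎_; inj₁; inj₂)
open import Data.Empty using (⊥; ⊥-elim)
open import Function using (_∘_; id)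
open import Function.Bundles using (Equivalence; mk⇔)
open import Function.Definitions using (Injective)
open import Relation.Binary.Definitions using (DecidableEquality)
open import Relation.Binary.PropositionalEquality
  using (_≡_; _≢_; refl; sym; trans; cong; cong₂; subst; module ≡-Reasoning)
open import Relation.Nullary using (yes; no; ¬_)

map-proj₁-consecutive : ∀ {A : Set} (xs : List A) a → map proj₁ (consecutive (xs ++ [ a ])) ≡ xs
map-proj₁-consecutive []           a = refl
map-proj₁-consecutive (x ∷ [])     a = refl
map-proj₁-consecutive (x ∷ y ∷ xs) a = cong (x ∷_) (map-proj₁-consecutive (y ∷ xs) a)

map-proj₂-consecutive : ∀ {A : Set} (a : A) xs → map proj₂ (consecutive (a ∷ xs)) ≡ xs
map-proj₂-consecutive a []       = refl
map-proj₂-consecutive a (x ∷ xs) = cong (x ∷_) (map-proj₂-consecutive x xs)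

map-proj₁-cycleEdges : ∀ {A : Set} (xs : List A) → map proj₁ (cycleEdges xs) ≡ xs
map-proj₁-cycleEdges []       = refl
map-proj₁-cycleEdges (a ∷ as) = map-proj₁-consecutive (a ∷ as) a

map-proj₂-cycleEdges : ∀ {A : Set} (a : A) as → map proj₂ (cycleEdges (a ∷ as)) ≡ as ++ [ a ]
map-proj₂-cycleEdges a as = map-proj₂-consecutive a (as ++ [ a ])

cycleEdges-unique : ∀ {A : Set} {xs : List A} → Unique xs → Unique (cycleEdges xs)
cycleEdges-unique {xs = xs} u = Unique.map⁻ (subst Unique (sym (map-proj₁-cycleEdges xs)) u)

∈-cycleEdges : ∀ {A : Set} {xs : List A} {p} → p ∈ cycleEdges xs → proj₁ p ∈ xs × proj₂ p ∈ xs
∈-cycleEdges {xs = a ∷ as} p∈ =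
  subst (_ ∈_) (map-proj₁-cycleEdges (a ∷ as)) (∈.∈-map⁺ proj₁ p∈) ,
  rotate (subst (_ ∈_) (map-proj₂-cycleEdges a as) (∈.∈-map⁺ proj₂ p∈))
  where
  rotate : ∀ {y} → y ∈ as ++ [ a ] → y ∈ a ∷ as
  rotate y∈ with ∈.∈-++⁻ as y∈
  ... | inj₁ y∈as        = there y∈as
  ... | inj₂ (here refl) = here refl

consecutive-irreflexive : ∀ {A : Set} {xs : List A} {p} → Unique xs → p ∈ consecutive xs → proj₁ p ≢ proj₂ p
consecutive-irreflexive {xs = a ∷ b ∷ xs} (a∉ ∷ _) (here refl) = All.head a∉
consecutive-irreflexive {xs = a ∷ b ∷ xs} (_ ∷ u)  (there p∈)  = consecutive-irreflexive u p∈

cycleEdges-irreflexive : ∀ {A : Set} {xs : List A} {p} → Unique xs → 2 ≤ length xs →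
                         p ∈ cycleEdges xs → proj₁ p ≢ proj₂ p
cycleEdges-irreflexive {xs = a ∷ []}     _        (s≤s ()) _
cycleEdges-irreflexive {xs = a ∷ b ∷ xs} (a∉ ∷ u) _ (here refl) = All.head a∉
cycleEdges-irreflexive {xs = a ∷ b ∷ xs} (a∉ ∷ u) _ (there p∈) =
  consecutive-irreflexive (Unique.++⁺ u (All.[] ∷ []) a-fresh) p∈
  where
  a-fresh : ∀ {y} → ¬ (y ∈ b ∷ xs × y ∈ [ a ])
  a-fresh (y∈ , here refl) = All.lookup a∉ y∈ refl

consecutive-applyUpTo : ∀ {A : Set} (f : ℕ → A) n →
                        consecutive (applyUpTo f (suc n)) ≡ applyUpTo (λ m → f m , f (suc m)) n
consecutive-applyUpTo f zero    = refl
consecutive-applyUpTo f (suc n) = cong ((f 0 , f 1) ∷_) (consecutive-applyUpTo (f ∘ suc) n)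

cycleEdges-applyUpTo : ∀ {A : Set} (f : ℕ → A) n → f (suc n) ≡ f 0 →
                       cycleEdges (applyUpTo f (suc n)) ≡ applyUpTo (λ m → f m , f (suc m)) (suc n)
cycleEdges-applyUpTo f n periodic = begin
  consecutive (applyUpTo f (suc n) ++ [ f 0 ])
    ≡⟨ cong (λ a → consecutive (applyUpTo f (suc n) ++ [ a ])) (sym periodic) ⟩
  consecutive (applyUpTo f (suc n) ++ [ f (suc n) ])
    ≡⟨ cong consecutive (List.applyUpTo-∷ʳ f (suc n)) ⟩
  consecutive (applyUpTo f (suc (suc n)))
    ≡⟨ consecutive-applyUpTo f (suc n) ⟩
  applyUpTo (λ m → f m , f (suc m)) (suc n) ∎
  where open ≡-Reasoning

lookup-injective : ∀ {A : Set} {xs : List A} → Unique xs → Injective _≡_ _≡_ (lookup xs)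
lookup-injective {xs = x ∷ xs} u        {f0}   {f0}   eq = refl
lookup-injective {xs = x ∷ xs} (x∉ ∷ u) {f0}   {fs j} eq = ⊥-elim (All.lookup x∉ (∈.∈-lookup j) eq)
lookup-injective {xs = x ∷ xs} (x∉ ∷ u) {fs i} {f0}   eq = ⊥-elim (All.lookup x∉ (∈.∈-lookup i) (sym eq))
lookup-injective {xs = x ∷ xs} (x∉ ∷ u) {fs i} {fs j} eq = cong fs (lookup-injective u eq)

injective⇒surjective : ∀ {m n} {f : Fin m → Fin n} → n ≤ m → Injective _≡_ _≡_ f →
                       ∀ y → ∃ λ x → f x ≡ y
injective⇒surjective {m} {suc n} {f} n<m f-inj y with Fin.any? (λ x → f x Fin.≟ y)
... | yes hit = hit
... | no ¬hit = ⊥-elim (ℕ.<-irrefl refl (ℕ.<-≤-trans n<m (Fin.injective⇒≤ punchOut-injective)))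
  where
  missed : ∀ x → y ≢ f x
  missed x y≡fx = ¬hit (x , sym y≡fx)
  punchOut-injective : Injective _≡_ _≡_ (λ x → punchOut (missed x))
  punchOut-injective eq = f-inj (Fin.punchOut-injective (missed _) (missed _) eq)

-- Counting occurrences

ends : ∀ {A : Set} → List (A × A) → List A
ends = concatMap λ p → proj₁ p ∷ proj₂ p ∷ []

module _ {A : Set} (_≟_ : DecidableEquality A) where

  occurrences : A → List A → ℕ
  occurrences x [] = 0
  occurrences x (y ∷ ys) with y ≟ x
  ... | yes _ = suc (occurrences x ys)
  ... | no _  = occurrences x ys

  occurrences-++ : ∀ x xs ys → occurrences x (xs ++ ys) ≡ occurrences x xs + occurrences x ys
  occurrences-++ x [] ys = refl
  occurrences-++ x (y ∷ xs) ys with y ≟ x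
  ... | yes _ = cong suc (occurrences-++ x xs ys)
  ... | no _  = occurrences-++ x xs ys

  occurrences-∉ : ∀ {x xs} → x ∉ xs → occurrences x xs ≡ 0
  occurrences-∉ {x} {[]} _ = refl
  occurrences-∉ {x} {y ∷ xs} x∉ with y ≟ x
  ... | yes refl = ⊥-elim (x∉ (here refl))
  ... | no _     = occurrences-∉ (x∉ ∘ there)

  occurrences-unique : ∀ {x xs} → Unique xs → x ∈ xs → occurrences x xs ≡ 1
  occurrences-unique {x} {y ∷ xs} (y∉ ∷ u) x∈ with y ≟ x | x∈
  ... | yes refl | _          = cong suc (occurrences-∉ (λ x∈xs → All.lookup y∉ x∈xs refl))
  ... | no y≢x   | here x≡y   = ⊥-elim (y≢x (sym x≡y))
  ... | no _     | there x∈xs = occurrences-unique u x∈xs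

  occurrences-∷-+ʳ : ∀ {x m xs ys} y → occurrences x xs ≡ m + occurrences x ys →
                     occurrences x (y ∷ xs) ≡ m + occurrences x (y ∷ ys)
  occurrences-∷-+ʳ {x} y eq with y ≟ x
  ... | yes _ = trans (cong suc eq) (sym (ℕ.+-suc _ _))
  ... | no _  = eq

  occurrences-ends : ∀ x ps → occurrences x (ends ps) ≡ occurrences x (map proj₁ ps) + occurrences x (map proj₂ ps)
  occurrences-ends x [] = refl
  occurrences-ends x ((a , b) ∷ ps) with a ≟ x
  ... | yes _ = cong suc (occurrences-∷-+ʳ b (occurrences-ends x ps))
  ... | no _  = occurrences-∷-+ʳ b (occurrences-ends x ps)

  occurrences-ends-cycleEdges : ∀ x xs → occurrences x (ends (cycleEdges xs)) ≡ 2 * occurrences x xs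
  occurrences-ends-cycleEdges x []       = refl
  occurrences-ends-cycleEdges x (a ∷ as) = begin
    occ (ends (cycleEdges (a ∷ as)))
      ≡⟨ occurrences-ends x (cycleEdges (a ∷ as)) ⟩
    occ (map proj₁ (cycleEdges (a ∷ as))) + occ (map proj₂ (cycleEdges (a ∷ as)))
      ≡⟨ cong₂ (λ l m → occ l + occ m) (map-proj₁-cycleEdges (a ∷ as)) (map-proj₂-cycleEdges a as) ⟩
    occ (a ∷ as) + occ (as ++ [ a ])
      ≡⟨ cong (occ (a ∷ as) +_) rotate ⟩
    occ (a ∷ as) + occ (a ∷ as)
      ≡⟨ cong (occ (a ∷ as) +_) (sym (ℕ.+-identityʳ _)) ⟩
    2 * occ (a ∷ as) ∎
    where
    open ≡-Reasoning
    occ : List A → ℕ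
    occ = occurrences x
    rotate : occ (as ++ [ a ]) ≡ occ (a ∷ as)
    rotate = begin
      occ (as ++ [ a ])   ≡⟨ occurrences-++ x as [ a ] ⟩
      occ as + occ [ a ]  ≡⟨ ℕ.+-comm (occ as) _ ⟩
      occ [ a ] + occ as  ≡⟨ occurrences-++ x [ a ] as ⟨
      occ (a ∷ as)        ∎

occurrences-map : ∀ {A B : Set} (_≟ᴬ_ : DecidableEquality A) (_≟ᴮ_ : DecidableEquality B)
                  {f : A → B} → Injective _≡_ _≡_ f →
                  ∀ x xs → occurrences _≟ᴮ_ (f x) (map f xs) ≡ occurrences _≟ᴬ_ x xs
occurrences-map _≟ᴬ_ _≟ᴮ_ {f} f-inj x [] = refl
occurrences-map _≟ᴬ_ _≟ᴮ_ {f} f-inj x (y ∷ xs) with f y ≟ᴮ f x | y ≟ᴬ x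
... | yes _     | yes _    = cong suc (occurrences-map _≟ᴬ_ _≟ᴮ_ f-inj x xs)
... | yes fy≡fx | no y≢x   = ⊥-elim (y≢x (f-inj fy≡fx))
... | no fy≢fx  | yes refl = ⊥-elim (fy≢fx refl)
... | no _      | no _     = occurrences-map _≟ᴬ_ _≟ᴮ_ f-inj x xs

occurrences-map≡length-filter : ∀ {A : Set} {n} (f : A → Fin n) v xs →
  occurrences Fin._≟_ v (map f xs) ≡ length (filter (λ x → f x Fin.≟ v) xs)
occurrences-map≡length-filter f v [] = refl
occurrences-map≡length-filter f v (x ∷ xs) with f x Fin.≟ v
... | yes _ = cong suc (occurrences-map≡length-filter f v xs)
... | no _  = occurrences-map≡length-filter f v xs

countEnds≡occurrences-ends : ∀ {n} (v : Fin n) es → countEnds v es ≡ occurrences Fin._≟_ v (ends es)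
countEnds≡occurrences-ends v [] = refl
countEnds≡occurrences-ends v ((a , b) ∷ es) with a Fin.≟ v
... | yes _ with b Fin.≟ v
...   | yes _ = cong (2 +_) (countEnds≡occurrences-ends v es)
...   | no _  = cong suc (countEnds≡occurrences-ends v es)
countEnds≡occurrences-ends v ((a , b) ∷ es) | no _ with b Fin.≟ v
...   | yes _ = cong suc (countEnds≡occurrences-ends v es)
...   | no _  = countEnds≡occurrences-ends v es

-- Darts, degrees and class I

allDarts : (G : Multigraph) → List (Dart G)
allDarts G = cartesianProduct (allFin (length (edges G))) (allFin 2)

allDarts-unique : ∀ G → Unique (allDarts G)
allDarts-unique G = Unique.cartesianProduct⁺ (Unique.allFin⁺ _) (Unique.allFin⁺ 2)

∈-allDarts : ∀ G (δ : Dart G) → δ ∈ allDarts G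
∈-allDarts G (e , i) = ∈.∈-cartesianProduct⁺ (∈.∈-allFin e) (∈.∈-allFin i)

ends-edges : ∀ G → ends (edges G) ≡ map (label G) (allDarts G)
ends-edges G = begin
  ends (edges G)                    ≡⟨ cong ends (List.tabulate-lookup (edges G)) ⟨
  ends (tabulate (endsOf G))        ≡⟨ cong ends (List.map-tabulate id (endsOf G)) ⟨
  ends (map (endsOf G) (allFin _))  ≡⟨ ends-map (allFin _) ⟩
  map (label G) (allDarts G)        ∎
  where
  open ≡-Reasoning
  ends-map : ∀ es → ends (map (endsOf G) es) ≡ map (label G) (cartesianProduct es (allFin 2))
  ends-map []       = refl
  ends-map (e ∷ es) = cong (λ l → endpt G e f0 ∷ endpt G e (fs f0) ∷ l) (ends-map es)

dartsAt : (G : Multigraph) → Fin (V G) → List (Dart G)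
dartsAt G v = filter (λ δ → label G δ Fin.≟ v) (allDarts G)

dartsAt-unique : ∀ G v → Unique (dartsAt G v)
dartsAt-unique G v = Unique.filter⁺ _ (allDarts-unique G)

label-dartsAt : ∀ G {v δ} → δ ∈ dartsAt G v → label G δ ≡ v
label-dartsAt G {v} δ∈ = proj₂ (∈.∈-filter⁻ (λ δ → label G δ Fin.≟ v) {xs = allDarts G} δ∈)

degree≡length-dartsAt : ∀ G v → degree G v ≡ length (dartsAt G v)
degree≡length-dartsAt G v = begin
  countEnds v (edges G)                               ≡⟨ countEnds≡occurrences-ends v (edges G) ⟩
  occurrences Fin._≟_ v (ends (edges G))              ≡⟨ cong (occurrences Fin._≟_ v) (ends-edges G) ⟩
  occurrences Fin._≟_ v (map (label G) (allDarts G))  ≡⟨ occurrences-map≡length-filter (label G) v (allDarts G) ⟩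
  length (dartsAt G v)                                ∎
  where open ≡-Reasoning

edge-label-injective : ∀ {G} → Loopless G → ∀ {δ δ' : Dart G} →
                       proj₁ δ ≡ proj₁ δ' → label G δ ≡ label G δ' → δ ≡ δ'
edge-label-injective loopless {e , f0}    {.e , f0}    refl _ = refl
edge-label-injective loopless {e , f0}    {.e , fs f0} refl l = ⊥-elim (loopless e l)
edge-label-injective loopless {e , fs f0} {.e , f0}    refl l = ⊥-elim (loopless e (sym l))
edge-label-injective loopless {e , fs f0} {.e , fs f0} refl _ = refl

module _ {G : Multigraph} {k} {c : Edge G → Fin k} (loopless : Loopless G) (proper : ProperColouring G k c) where

  label-colour-injective : ∀ {δ δ'} → label G δ ≡ label G δ' → c (proj₁ δ) ≡ c (proj₁ δ') → δ ≡ δ'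
  label-colour-injective {e , i} {e' , i'} same-label same-colour with e Fin.≟ e'
  ... | yes same-edge = edge-label-injective loopless same-edge same-label
  ... | no e≢e'       = ⊥-elim (proper e e' (e≢e' , i , i' , same-label) same-colour)

  colour-dartsAt-injective : ∀ v → Injective _≡_ _≡_ (c ∘ proj₁ ∘ lookup (dartsAt G v))
  colour-dartsAt-injective v same-colour = lookup-injective (dartsAt-unique G v)
    (label-colour-injective (trans (label-dartsAt G (∈.∈-lookup _)) (sym (label-dartsAt G (∈.∈-lookup _)))) same-colour)

degree≤colours : ∀ {G k} → Loopless G → Colourable G k → ∀ v → degree G v ≤ k
degree≤colours {G} loopless (c , proper) v =
  subst (_≤ _) (sym (degree≡length-dartsAt G v)) (Fin.injective⇒≤ (colour-dartsAt-injective loopless proper v))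

maximum-constant : ∀ {n d} (f : Fin n → ℕ) → 0 < n → (∀ i → f i ≡ d) → foldr _⊔_ 0 (map f (allFin n)) ≡ d
maximum-constant {suc n} f _ f≡d = maximum-all (All.map⁺ {xs = allFin (suc n)} (All.tabulate λ {i} _ → f≡d i))
  where
  maximum-all : ∀ {m x xs} → All (_≡ m) (x ∷ xs) → foldr _⊔_ 0 (x ∷ xs) ≡ m
  maximum-all (refl ∷ [])           = ℕ.⊔-identityʳ _
  maximum-all {m} (refl ∷ px ∷ pxs) = trans (cong (m ⊔_) (maximum-all (px ∷ pxs))) (ℕ.⊔-idem m)

maximum-empty : ∀ {n} (f : Fin n → ℕ) → n ≡ 0 → foldr _⊔_ 0 (map f (allFin n)) ≡ 0
maximum-empty f refl = refl

edgeless : ∀ {G} → V G ≡ 0 → ¬ Edge G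
edgeless {G} V≡0 e = Fin.¬Fin0 (subst Fin V≡0 (endpt G e f0))

colourable-edgeless : ∀ {G} → ¬ Edge G → ∀ k → Colourable G k
colourable-edgeless no-edge k = (λ e → ⊥-elim (no-edge e)) , (λ e → ⊥-elim (no-edge e))

classI-regular : ∀ {G d} → Loopless G → Regular G d → Colourable G d → ClassI G
classI-regular {G} loopless regular colourable with V G ℕ.≟ 0
... | yes V≡0 = subst (ChromaticIndex G) (sym (maximum-empty (degree G) V≡0))
                  (colourable-edgeless {G} (edgeless {G} V≡0) 0 , λ _ _ → z≤n)
... | no V≢0  = subst (ChromaticIndex G) (sym (maximum-constant (degree G) 0<V regular))
                  (colourable , λ k colourable-k → subst (_≤ k) (regular v) (degree≤colours loopless colourable-k v))
  where
  0<V : 0 < V G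
  0<V = ℕ.n≢0⇒n>0 V≢0
  v : Fin (V G)
  v = fromℕ< 0<V

colourable-regular : ∀ {G d} → Regular G d → ClassI G → Colourable G d
colourable-regular {G} {d} regular (colourable , _) with V G ℕ.≟ 0
... | yes V≡0 = colourable-edgeless {G} (edgeless {G} V≡0) d
... | no V≢0  = subst (Colourable G) (maximum-constant (degree G) (ℕ.n≢0⇒n>0 V≢0) regular) colourable

-- Cyclic truncations

module Darts (X : Multigraph) where

  _≟ᵈ_ : DecidableEquality (Dart X)
  _≟ᵈ_ = Product.≡-dec Fin._≟_ Fin._≟_

  encDart-injective : Injective _≡_ _≡_ (encDart X)
  encDart-injective {e , i} {e' , i'} eq =
    cong₂ _,_ (Fin.combine-injectiveˡ e i e' i' eq) (Fin.combine-injectiveʳ e i e' i' eq)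

  encPair-injective : Injective _≡_ _≡_ (encPair X)
  encPair-injective eq = cong₂ _,_ (encDart-injective (cong proj₁ eq)) (encDart-injective (cong proj₂ eq))

  decodeDart : Fin (length (edges X) * 2) → Dart X
  decodeDart = remQuot 2

  encDart-decodeDart : ∀ y → encDart X (decodeDart y) ≡ y
  encDart-decodeDart = Fin.combine-remQuot {length (edges X)} 2

  decodeDart-encDart : ∀ δ → decodeDart (encDart X δ) ≡ δ
  decodeDart-encDart (e , i) = Fin.remQuot-combine e i

  ends-map-encPair : ∀ ps → ends (map (encPair X) ps) ≡ map (encDart X) (ends ps)
  ends-map-encPair []       = refl
  ends-map-encPair (p ∷ ps) = cong (λ l → encDart X (proj₁ p) ∷ encDart X (proj₂ p) ∷ l) (ends-map-encPair ps)

  rung : Edge X → Dart X × Dart X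
  rung e = (e , f0) , (e , fs f0)

  ends-rungs : ∀ es → ends (map rung es) ≡ cartesianProduct es (allFin 2)
  ends-rungs []       = refl
  ends-rungs (e ∷ es) = cong (λ l → (e , f0) ∷ (e , fs f0) ∷ l) (ends-rungs es)

module _ {X : Multigraph} (T : CyclicData X) where

  open Darts X

  clusters : List (Dart X)
  clusters = concatMap (cyc T) (allFin (V X))

  rungs cycles truncationPairs : List (Dart X × Dart X)
  rungs           = map rung (allFin (length (edges X)))
  cycles          = concatMap (cycleEdges ∘ cyc T) (allFin (V X))
  truncationPairs = rungs ++ cycles

  edges-truncation : edges (truncation X T) ≡ map (encPair X) truncationPairs
  edges-truncation = sym (begin
    map (encPair X) (rungs ++ cycles)
      ≡⟨ List.map-++ (encPair X) rungs cycles ⟩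
    map (encPair X) rungs ++ map (encPair X) cycles
      ≡⟨ cong₂ _++_ (sym (List.map-∘ (allFin _))) (List.map-concatMap (encPair X) (cycleEdges ∘ cyc T) (allFin (V X))) ⟩
    edges (truncation X T) ∎)
    where open ≡-Reasoning

  label-cyc : ∀ {v δ} → δ ∈ cyc T v → label X δ ≡ v
  label-cyc {v} {δ} = Equivalence.to (cluster T v δ)

  ∈-cyc : ∀ δ → δ ∈ cyc T (label X δ)
  ∈-cyc δ = Equivalence.from (cluster T (label X δ) δ) refl

  cyc-disjoint : ∀ {v w δ} → v ≢ w → δ ∈ cyc T v → δ ∈ cyc T w → ⊥
  cyc-disjoint v≢w δ∈v δ∈w = v≢w (trans (sym (label-cyc δ∈v)) (label-cyc δ∈w))

  cycleEdges-cyc-irreflexive : ∀ {v p} → p ∈ cycleEdges (cyc T v) → proj₁ p ≢ proj₂ p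
  cycleEdges-cyc-irreflexive {v} = cycleEdges-irreflexive (unique T v) (ℕ.≤-trans (ℕ.n≤1+n 2) (long T v))

  clusters-unique : Unique clusters
  clusters-unique = Unique.concat⁺
    (All.map⁺ (All.tabulate λ {v} _ → unique T v))
    (AllPairs.map⁺ (AllPairs.map (λ v≢w {_} (δ∈v , δ∈w) → cyc-disjoint v≢w δ∈v δ∈w) (Unique.allFin⁺ (V X))))

  ∈-clusters : ∀ δ → δ ∈ clusters
  ∈-clusters δ = ∈.∈-concat⁺′ (∈-cyc δ) (∈.∈-map⁺ (cyc T) (∈.∈-allFin (label X δ)))

  occurrences-ends-cycles : ∀ δ vs → occurrences _≟ᵈ_ δ (ends (concatMap (cycleEdges ∘ cyc T) vs)) ≡
                                     2 * occurrences _≟ᵈ_ δ (concatMap (cyc T) vs)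
  occurrences-ends-cycles δ []       = refl
  occurrences-ends-cycles δ (v ∷ vs) = begin
    occ (ends (cycleEdges (cyc T v) ++ rest))
      ≡⟨ cong occ (List.concatMap-++ _ (cycleEdges (cyc T v)) rest) ⟩
    occ (ends (cycleEdges (cyc T v)) ++ ends rest)
      ≡⟨ occurrences-++ _≟ᵈ_ δ (ends (cycleEdges (cyc T v))) (ends rest) ⟩
    occ (ends (cycleEdges (cyc T v))) + occ (ends rest)
      ≡⟨ cong₂ _+_ (occurrences-ends-cycleEdges _≟ᵈ_ δ (cyc T v)) (occurrences-ends-cycles δ vs) ⟩
    2 * occ (cyc T v) + 2 * occ (concatMap (cyc T) vs)
      ≡⟨ ℕ.*-distribˡ-+ 2 (occ (cyc T v)) _ ⟨
    2 * (occ (cyc T v) + occ (concatMap (cyc T) vs))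
      ≡⟨ cong (2 *_) (occurrences-++ _≟ᵈ_ δ (cyc T v) _) ⟨
    2 * occ (concatMap (cyc T) (v ∷ vs)) ∎
    where
    open ≡-Reasoning
    occ : List (Dart X) → ℕ
    occ = occurrences _≟ᵈ_ δ
    rest : List (Dart X × Dart X)
    rest = concatMap (cycleEdges ∘ cyc T) vs

  occurrences-ends-truncationPairs : ∀ δ → occurrences _≟ᵈ_ δ (ends truncationPairs) ≡ 3
  occurrences-ends-truncationPairs δ = begin
    occ (ends (rungs ++ cycles))          ≡⟨ cong occ (List.concatMap-++ _ rungs cycles) ⟩
    occ (ends rungs ++ ends cycles)       ≡⟨ occurrences-++ _≟ᵈ_ δ (ends rungs) (ends cycles) ⟩
    occ (ends rungs) + occ (ends cycles)  ≡⟨ cong₂ _+_ (cong occ (ends-rungs (allFin _)))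
                                                       (occurrences-ends-cycles δ (allFin (V X))) ⟩
    occ (allDarts X) + 2 * occ clusters   ≡⟨ cong₂ (λ m n → m + 2 * n)
                                               (occurrences-unique _≟ᵈ_ (allDarts-unique X) (∈-allDarts X δ))
                                               (occurrences-unique _≟ᵈ_ clusters-unique (∈-clusters δ)) ⟩
    3                                     ∎
    where
    open ≡-Reasoning
    occ : List (Dart X) → ℕ
    occ = occurrences _≟ᵈ_ δ

  truncation-cubic : Regular (truncation X T) 3
  truncation-cubic y = begin
    countEnds y (edges (truncation X T))         ≡⟨ countEnds≡occurrences-ends y (edges (truncation X T)) ⟩
    occ y (ends (edges (truncation X T)))        ≡⟨ cong (occ y) (trans (cong ends edges-truncation)
                                                                        (ends-map-encPair truncationPairs)) ⟩
    occ y (map (encDart X) darts)                ≡⟨ cong (λ z → occ z (map (encDart X) darts)) (encDart-decodeDart y) ⟨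
    occ (encDart X δ) (map (encDart X) darts)    ≡⟨ occurrences-map _≟ᵈ_ Fin._≟_ encDart-injective δ darts ⟩
    occurrences _≟ᵈ_ δ darts                     ≡⟨ occurrences-ends-truncationPairs δ ⟩
    3                                            ∎
    where
    open ≡-Reasoning
    occ : Fin (V (truncation X T)) → List (Fin (V (truncation X T))) → ℕ
    occ = occurrences Fin._≟_
    darts : List (Dart X)
    darts = ends truncationPairs
    δ : Dart X
    δ = decodeDart y

  ∈-cycles⁻ : ∀ {p} → p ∈ cycles → ∃ λ v → p ∈ cycleEdges (cyc T v)
  ∈-cycles⁻ p∈ = Any.satisfied (∈.∈-concatMap⁻ (cycleEdges ∘ cyc T) {xs = allFin (V X)} p∈)

  ∈-truncationPairs⁻ : ∀ {p} → p ∈ truncationPairs → (∃ λ e → p ≡ rung e) ⊎ (∃ λ v → p ∈ cycleEdges (cyc T v))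
  ∈-truncationPairs⁻ p∈ with ∈.∈-++⁻ rungs p∈
  ... | inj₁ p∈rungs  = inj₁ (map₂ proj₂ (∈.∈-map⁻ rung p∈rungs))
  ... | inj₂ p∈cycles = inj₂ (∈-cycles⁻ p∈cycles)

  truncationPairs-irreflexive : ∀ {p} → p ∈ truncationPairs → proj₁ p ≢ proj₂ p
  truncationPairs-irreflexive p∈ with ∈-truncationPairs⁻ p∈
  ... | inj₁ (e , refl) = λ ()
  ... | inj₂ (v , p∈v)  = cycleEdges-cyc-irreflexive p∈v

  truncationEdge-view : ∀ j → ∃ λ p → p ∈ truncationPairs × lookup (edges (truncation X T)) j ≡ encPair X p
  truncationEdge-view j =
    ∈.∈-map⁻ (encPair X) (subst (lookup (edges (truncation X T)) j ∈_) edges-truncation (∈.∈-lookup j))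

  truncation-loopless : Loopless (truncation X T)
  truncation-loopless j with truncationEdge-view j
  ... | p , p∈ , eq = λ same-end → truncationPairs-irreflexive p∈
                        (encDart-injective (trans (sym (cong proj₁ eq)) (trans same-end (cong proj₂ eq))))

  module _ (loopless : Loopless X) where

    cycleEdge-edges-distinct : ∀ {v p} → p ∈ cycleEdges (cyc T v) → proj₁ (proj₁ p) ≢ proj₁ (proj₂ p)
    cycleEdge-edges-distinct p∈ same-edge with ∈-cycleEdges p∈
    ... | δ₀∈ , δ₁∈ = cycleEdges-cyc-irreflexive p∈
                        (edge-label-injective loopless same-edge (trans (label-cyc δ₀∈) (sym (label-cyc δ₁∈))))

    truncationPairs-unique : Unique truncationPairs
    truncationPairs-unique = Unique.++⁺
      (Unique.map⁺ (cong (proj₁ ∘ proj₁)) (Unique.allFin⁺ _))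
      (Unique.concat⁺
        (All.map⁺ (All.tabulate λ {v} _ → cycleEdges-unique (unique T v)))
        (AllPairs.map⁺ (AllPairs.map (λ v≢w {_} (p∈v , p∈w) → cycleEdges-disjoint v≢w p∈v p∈w) (Unique.allFin⁺ (V X)))))
      rungs-cycles-disjoint
      where
      cycleEdges-disjoint : ∀ {v w p} → v ≢ w → p ∈ cycleEdges (cyc T v) → p ∈ cycleEdges (cyc T w) → ⊥
      cycleEdges-disjoint v≢w p∈v p∈w = cyc-disjoint v≢w (proj₁ (∈-cycleEdges p∈v)) (proj₁ (∈-cycleEdges p∈w))
      rungs-cycles-disjoint : ∀ {p} → ¬ (p ∈ rungs × p ∈ cycles)
      rungs-cycles-disjoint (p∈rungs , p∈cycles) with ∈.∈-map⁻ rung p∈rungs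
      ... | _ , _ , refl = cycleEdge-edges-distinct (proj₂ (∈-cycles⁻ p∈cycles)) refl

    truncation-simple : Unique (edges (truncation X T))
    truncation-simple = subst Unique (sym edges-truncation) (Unique.map⁺ encPair-injective truncationPairs-unique)

-- Clusters ordered by colour

module ColourOrder {X : Multigraph} {n} (loopless : Loopless X) (regular : Regular X (suc n))
                   {c : Edge X → Fin (suc n)} (proper : ProperColouring X (suc n) c) where

  d : ℕ
  d = suc n

  position : Dart X → ℕ
  position δ = toℕ (c (proj₁ δ))

  position<d : ∀ δ → position δ < d
  position<d δ = Fin.toℕ<n (c (proj₁ δ))

  dartOfColour : ∀ v κ → ∃ λ δ → label X δ ≡ v × c (proj₁ δ) ≡ κ
  dartOfColour v κ with injective⇒surjective d≤ (colour-dartsAt-injective loopless proper v) κ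
    where d≤ : d ≤ length (dartsAt X v)
          d≤ = ℕ.≤-reflexive (trans (sym (regular v)) (degree≡length-dartsAt X v))
  ... | i , colour≡κ = lookup (dartsAt X v) i , label-dartsAt X (∈.∈-lookup i) , colour≡κ

  cycleDart : Fin (V X) → ℕ → Dart X
  cycleDart v m = proj₁ (dartOfColour v (m mod d))

  label-cycleDart : ∀ v m → label X (cycleDart v m) ≡ v
  label-cycleDart v m = proj₁ (proj₂ (dartOfColour v (m mod d)))

  position-cycleDart : ∀ v m → position (cycleDart v m) ≡ m % d
  position-cycleDart v m = trans (cong toℕ (proj₂ (proj₂ (dartOfColour v (m mod d))))) (Fin.toℕ-fromℕ< _)

  position-cycleDart-< : ∀ v {m} → m < d → position (cycleDart v m) ≡ m
  position-cycleDart-< v {m} m<d = trans (position-cycleDart v m) (m<n⇒m%n≡m m<d)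

  cycleDart-position : ∀ δ → cycleDart (label X δ) (position δ) ≡ δ
  cycleDart-position δ = label-colour-injective loopless proper (label-cycleDart (label X δ) (position δ))
    (Fin.toℕ-injective (position-cycleDart-< (label X δ) (position<d δ)))

  cycleDart-periodic : ∀ v → cycleDart v d ≡ cycleDart v 0
  cycleDart-periodic v =
    cong (λ κ → proj₁ (dartOfColour v κ)) (Fin.fromℕ<-cong (d % d) 0 (n%n≡0 d) (m%n<n d d) (m%n<n 0 d))

  colourCycle : Fin (V X) → List (Dart X)
  colourCycle v = applyUpTo (cycleDart v) d

  colourCycle-unique : ∀ v → Unique (colourCycle v)
  colourCycle-unique v = Unique.applyUpTo⁺₁ (cycleDart v) d λ {i} {j} i<j j<d same → ℕ.<-irrefl
    (trans (sym (position-cycleDart-< v (ℕ.<-trans i<j j<d))) (trans (cong position same) (position-cycleDart-< v j<d)))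
    i<j

  ∈-colourCycle⁻ : ∀ {v δ} → δ ∈ colourCycle v → label X δ ≡ v
  ∈-colourCycle⁻ {v} δ∈ with ∈.∈-applyUpTo⁻ (cycleDart v) δ∈
  ... | m , _ , refl = label-cycleDart v m

  ∈-colourCycle⁺ : ∀ δ → δ ∈ colourCycle (label X δ)
  ∈-colourCycle⁺ δ = subst (_∈ colourCycle (label X δ)) (cycleDart-position δ)
    (∈.∈-applyUpTo⁺ (cycleDart (label X δ)) (position<d δ))

  cycleEdges-colourCycle : ∀ v → cycleEdges (colourCycle v) ≡ applyUpTo (λ m → cycleDart v m , cycleDart v (suc m)) d
  cycleEdges-colourCycle v = cycleEdges-applyUpTo (cycleDart v) n (cycleDart-periodic v)

  colourCycles : 2 ≤ n → CyclicData X
  colourCycles 2≤n = record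
    { cyc     = colourCycle
    ; unique  = colourCycle-unique
    ; cluster = λ v δ → mk⇔ ∈-colourCycle⁻ λ { refl → ∈-colourCycle⁺ δ }
    ; long    = λ v → subst (3 ≤_) (sym (List.length-applyUpTo (cycleDart v) d)) (s≤s 2≤n)
    }

-- A proper 3-colouring of the cycle of positions 0 → 1 → ⋯ → n → 0

third : Fin 3 → Fin 3 → Fin 3
third f0           (fs f0) = fs (fs f0)
third (fs f0)      f0      = fs (fs f0)
third f0           _       = fs f0
third (fs f0)      _       = f0
third (fs (fs f0)) f0      = fs f0
third (fs (fs f0)) _       = f0

third-fresh : ∀ a b → third a b ≢ a × third a b ≢ b
third-fresh f0           f0           = (λ ()) , (λ ())
third-fresh f0           (fs f0)      = (λ ()) , (λ ())
third-fresh f0           (fs (fs f0)) = (λ ()) , (λ ())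
third-fresh (fs f0)      f0           = (λ ()) , (λ ())
third-fresh (fs f0)      (fs f0)      = (λ ()) , (λ ())
third-fresh (fs f0)      (fs (fs f0)) = (λ ()) , (λ ())
third-fresh (fs (fs f0)) f0           = (λ ()) , (λ ())
third-fresh (fs (fs f0)) (fs f0)      = (λ ()) , (λ ())
third-fresh (fs (fs f0)) (fs (fs f0)) = (λ ()) , (λ ())

parity : ℕ → Fin 3
parity zero          = f0
parity (suc zero)    = fs f0
parity (suc (suc k)) = parity k

parity-suc : ∀ k → parity (suc k) ≢ parity k
parity-suc zero          ()
parity-suc (suc zero)    ()
parity-suc (suc (suc k)) = parity-suc k

parity≢2 : ∀ k → parity k ≢ fs (fs f0)
parity≢2 zero          ()
parity≢2 (suc zero)    ()
parity≢2 (suc (suc k)) = parity≢2 k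

data Incidence : Set where
  viaRung viaNext viaPrev : Incidence

module CycleColouring (n : ℕ) (0<n : 0 < n) where

  prev : ℕ → ℕ
  prev zero    = n
  prev (suc κ) = κ

  cycleColour : ℕ → Fin 3
  cycleColour κ with κ ℕ.≟ n
  ... | yes _ = fs (fs f0)
  ... | no _  = parity κ

  cycleColour-last : cycleColour n ≡ fs (fs f0)
  cycleColour-last with n ℕ.≟ n
  ... | yes _  = refl
  ... | no n≢n = ⊥-elim (n≢n refl)

  cycleColour-parity : ∀ {κ} → κ ≢ n → cycleColour κ ≡ parity κ
  cycleColour-parity {κ} κ≢n with κ ℕ.≟ n
  ... | yes κ≡n = ⊥-elim (κ≢n κ≡n)
  ... | no _    = refl

  cycleColour-prev : ∀ {κ} → κ ≤ n → cycleColour κ ≢ cycleColour (prev κ)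
  cycleColour-prev {zero} _ eq =
    parity≢2 0 (trans (sym (cycleColour-parity (ℕ.<⇒≢ 0<n))) (trans eq cycleColour-last))
  cycleColour-prev {suc κ} κ<n eq with ℕ.m≤n⇒m<n∨m≡n κ<n
  ... | inj₂ refl  = parity≢2 κ (trans (sym (cycleColour-parity (ℕ.<⇒≢ κ<n))) (trans (sym eq) cycleColour-last))
  ... | inj₁ κ+1<n = parity-suc κ (trans (sym (cycleColour-parity (ℕ.<⇒≢ κ+1<n)))
                                    (trans eq (cycleColour-parity (ℕ.<⇒≢ κ<n))))

  colourAt : ℕ → Incidence → Fin 3
  colourAt κ viaRung = third (cycleColour κ) (cycleColour (prev κ))
  colourAt κ viaNext = cycleColour κ
  colourAt κ viaPrev = cycleColour (prev κ)

  colourAt-injective : ∀ {κ} → κ ≤ n → ∀ {i j} → colourAt κ i ≡ colourAt κ j → i ≡ j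
  colourAt-injective _   {viaRung} {viaRung} _  = refl
  colourAt-injective _   {viaNext} {viaNext} _  = refl
  colourAt-injective _   {viaPrev} {viaPrev} _  = refl
  colourAt-injective _   {viaRung} {viaNext} eq = ⊥-elim (proj₁ (third-fresh _ _) eq)
  colourAt-injective _   {viaRung} {viaPrev} eq = ⊥-elim (proj₂ (third-fresh _ _) eq)
  colourAt-injective _   {viaNext} {viaRung} eq = ⊥-elim (proj₁ (third-fresh _ _) (sym eq))
  colourAt-injective _   {viaPrev} {viaRung} eq = ⊥-elim (proj₂ (third-fresh _ _) (sym eq))
  colourAt-injective κ≤n {viaNext} {viaPrev} eq = ⊥-elim (cycleColour-prev κ≤n eq)
  colourAt-injective κ≤n {viaPrev} {viaNext} eq = ⊥-elim (cycleColour-prev κ≤n (sym eq))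

-- The colouring of the colour-ordered truncation

pairEnd : ∀ {A : Set} → Fin 2 → A × A → A
pairEnd f0     = proj₁
pairEnd (fs _) = proj₂

module TruncationColouring {X : Multigraph} {n} (loopless : Loopless X) (regular : Regular X (suc n))
                           {c : Edge X → Fin (suc n)} (proper : ProperColouring X (suc n) c) (2≤n : 2 ≤ n) where

  open ColourOrder loopless regular proper
  open CycleColouring n (ℕ.<-≤-trans (s≤s z≤n) 2≤n)
  open Darts X

  T : CyclicData X
  T = colourCycles 2≤n

  prev-suc-% : ∀ {m} → m < d → prev (suc m % d) ≡ m
  prev-suc-% {m} m<d with ℕ.m≤n⇒m<n∨m≡n m<d
  ... | inj₁ m+1<d = cong prev (m<n⇒m%n≡m m+1<d)
  ... | inj₂ refl  = cong prev (n%n≡0 d)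

  edgeAt : Dart X → Incidence → Dart X × Dart X
  edgeAt δ viaRung = rung (proj₁ δ)
  edgeAt δ viaNext = δ , cycleDart (label X δ) (suc (position δ))
  edgeAt δ viaPrev = cycleDart (label X δ) (prev (position δ)) , δ

  -- A truncation edge is a rung exactly when its two darts lie on the same edge of X.
  pairColour : Dart X × Dart X → Fin 3
  pairColour ((e , _) , (e' , _)) with e Fin.≟ e'
  ... | yes _ = colourAt (toℕ (c e)) viaRung
  ... | no _  = colourAt (toℕ (c e)) viaNext

  pairColour-rung : ∀ e → pairColour (rung e) ≡ colourAt (toℕ (c e)) viaRung
  pairColour-rung e with e Fin.≟ e
  ... | yes _  = refl
  ... | no e≢e = ⊥-elim (e≢e refl)

  pairColour-cycleEdge : ∀ δ δ' → proj₁ δ ≢ proj₁ δ' → pairColour (δ , δ') ≡ colourAt (position δ) viaNext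
  pairColour-cycleEdge (e , _) (e' , _) e≢e' with e Fin.≟ e'
  ... | yes e≡e' = ⊥-elim (e≢e' e≡e')
  ... | no _     = refl

  Incident : Dart X × Dart X → Fin 2 → Set
  Incident p s = ∃ λ i → p ≡ edgeAt (pairEnd s p) i × pairColour p ≡ colourAt (position (pairEnd s p)) i

  rung-incident : ∀ e s → Incident (rung e) s
  rung-incident e f0     = viaRung , refl , pairColour-rung e
  rung-incident e (fs _) = viaRung , refl , pairColour-rung e

  consecutiveDarts-incident : ∀ {v m} → m < d → proj₁ (cycleDart v m) ≢ proj₁ (cycleDart v (suc m)) →
                              ∀ s → Incident (cycleDart v m , cycleDart v (suc m)) s
  consecutiveDarts-incident {v} {m} m<d distinct f0 = viaNext ,
    cong₂ (λ w k → cycleDart v m , cycleDart w (suc k)) (sym (label-cycleDart v m)) (sym (position-cycleDart-< v m<d)) ,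
    pairColour-cycleEdge (cycleDart v m) (cycleDart v (suc m)) distinct
  consecutiveDarts-incident {v} {m} m<d distinct (fs _) = viaPrev ,
    cong₂ (λ w k → cycleDart w k , cycleDart v (suc m)) (sym (label-cycleDart v (suc m))) (sym prev-position) ,
    trans (pairColour-cycleEdge (cycleDart v m) (cycleDart v (suc m)) distinct)
          (cong cycleColour (trans (position-cycleDart-< v m<d) (sym prev-position)))
    where
    prev-position : prev (position (cycleDart v (suc m))) ≡ m
    prev-position = trans (cong prev (position-cycleDart v (suc m))) (prev-suc-% m<d)

  cycleEdge-incident : ∀ {v p} → p ∈ cycleEdges (colourCycle v) → ∀ s → Incident p s
  cycleEdge-incident {v} p∈ s
    with ∈.∈-applyUpTo⁻ (λ m → cycleDart v m , cycleDart v (suc m)) (subst (_ ∈_) (cycleEdges-colourCycle v) p∈)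
  ... | m , m<d , refl = consecutiveDarts-incident m<d (cycleEdge-edges-distinct T loopless p∈) s

  truncationPair-incident : ∀ {p} → p ∈ truncationPairs T → ∀ s → Incident p s
  truncationPair-incident p∈ s with ∈-truncationPairs⁻ T p∈
  ... | inj₁ (e , refl) = rung-incident e s
  ... | inj₂ (v , p∈v)  = cycleEdge-incident p∈v s

  incident-injective : ∀ {p p' s s'} → Incident p s → Incident p' s' → pairEnd s p ≡ pairEnd s' p' →
                       pairColour p ≡ pairColour p' → p ≡ p'
  incident-injective {p} {s = s} (i , p≡ , colour≡) (i' , p'≡ , colour'≡) same-end same-colour =
    trans p≡ (trans (cong₂ edgeAt same-end same-incidence) (sym p'≡))
    where
    same-incidence : i ≡ i'
    same-incidence = colourAt-injective (ℕ.≤-pred (position<d (pairEnd s p)))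
      (trans (sym colour≡) (trans same-colour (trans colour'≡ (cong (λ δ → colourAt (position δ) i') (sym same-end)))))

  decodePair : Fin (length (edges X) * 2) × Fin (length (edges X) * 2) → Dart X × Dart X
  decodePair (a , b) = decodeDart a , decodeDart b

  decodePair-encPair : ∀ p → decodePair (encPair X p) ≡ p
  decodePair-encPair (δ , δ') = cong₂ _,_ (decodeDart-encDart δ) (decodeDart-encDart δ')

  truncationColouring : Edge (truncation X T) → Fin 3
  truncationColouring j = pairColour (decodePair (lookup (edges (truncation X T)) j))

  truncationColouring-encPair : ∀ {j p} → lookup (edges (truncation X T)) j ≡ encPair X p →
                                truncationColouring j ≡ pairColour p
  truncationColouring-encPair {p = p} eq = trans (cong (pairColour ∘ decodePair) eq) (cong pairColour (decodePair-encPair p))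

  endpt-encPair : ∀ {j p} → lookup (edges (truncation X T)) j ≡ encPair X p → ∀ s →
                  endpt (truncation X T) j s ≡ encDart X (pairEnd s p)
  endpt-encPair eq f0     = cong proj₁ eq
  endpt-encPair eq (fs _) = cong proj₂ eq

  truncationColouring-proper : ProperColouring (truncation X T) 3 truncationColouring
  truncationColouring-proper j j' (j≢j' , s , s' , same-end) same-colour =
    j≢j' (lookup-injective (truncation-simple T loopless) (same-pair (truncationEdge-view T j) (truncationEdge-view T j')))
    where
    same-pair : (∃ λ p → p ∈ truncationPairs T × lookup (edges (truncation X T)) j ≡ encPair X p) →
                (∃ λ p → p ∈ truncationPairs T × lookup (edges (truncation X T)) j' ≡ encPair X p) →
                lookup (edges (truncation X T)) j ≡ lookup (edges (truncation X T)) j'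
    same-pair (p , p∈ , eq) (p' , p'∈ , eq') = trans eq (trans (cong (encPair X) p≡p') (sym eq'))
      where
      p≡p' : p ≡ p'
      p≡p' = incident-injective {s = s} {s' = s'} (truncationPair-incident p∈ s) (truncationPair-incident p'∈ s')
        (encDart-injective (trans (sym (endpt-encPair eq s)) (trans same-end (endpt-encPair eq' s'))))
        (trans (sym (truncationColouring-encPair eq)) (trans same-colour (truncationColouring-encPair eq')))

  truncation-classI : ClassI (truncation X T)
  truncation-classI =
    classI-regular (truncation-loopless T) (truncation-cubic T) (truncationColouring , truncationColouring-proper)

classI-cyclicTruncation : ∀ {X d} → Loopless X → Regular X d → 3 ≤ d → ClassI X →
                          Σ (CyclicData X) λ T → ClassI (truncation X T)
classI-cyclicTruncation {d = suc n} loopless regular (s≤s 2≤n) classI = T , truncation-classI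
  where open TruncationColouring loopless regular (proj₂ (colourable-regular regular classI)) 2≤n

-- Odd valency only serves to exclude d = 2, where clusters are too short to be cycles.
odd>1⇒3≤ : ∀ {d} → d % 2 ≡ 1 → 1 < d → 3 ≤ d
odd>1⇒3≤ {suc zero}          _  (s≤s ())
odd>1⇒3≤ {suc (suc zero)}    ()  _
odd>1⇒3≤ {suc (suc (suc _))} _  _ = s≤s (s≤s (s≤s z≤n))

corollary5p3 : (X : Multigraph) (d : ℕ) → Loopless X → Regular X d →
               d % 2 ≡ 1 → 1 < d → ClassI X →
               Σ (CyclicData X) λ T → ClassI (truncation X T)
corollary5p3 X d loopless regular odd 1<d classI =
  classI-cyclicTruncation loopless regular (odd>1⇒3≤ odd 1<d) classI
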